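{- Let $G$ be a connected bidirected graph, let $p$ be a prime, let $\psi$ be a $\mathbb{Z}_p$-flow of $G$, and assume that either $p$ is odd or $\sigma_G(\mathrm{supp}(\psi))=1$. Then there is a $\mathbb{Z}$-flow $\phi$ of $G$ such that $\phi(e)\equiv\psi(e)\pmod p$ for every $e\in E(G)$.
   Context: Graphs are finite and may have loops and parallel edges; each edge consists of two half-edges, each incident with an end of the edge (a loop has both at its end); $H(v)$ is the set of half-edges at $v$ and $e_h$ the edge containing half-edge $h$. A bidirected graph is a graph $G$ with a signature $\sigma_G:E(G)\to\{\pm1\}$ and an orientation $\tau:H(G)\to\{\pm1\}$ with $\prod_{h\in H(e)}\tau(h)=-\sigma_G(e)$ for every edge $e$; for $S\subseteq E(G)$, $\sigma_G(S)=\prod_{e\in S}\sigma_G(e)$. For an abelian group $\Gamma$ and $\phi:E(G)\to\Gamma$, $\partial\phi(v)=\sum_{h\in H(v)}\tau(h)\phi(e_h)$, and $\phi$ is a $\Gamma$-flow if $\partial\phi=0$. -}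

module Defs where

open import Data.Nat using (ℕ; zero; suc)
open import Data.Fin using (Fin; toℕ; _≟_)
import Data.Fin as F
open import Data.Integer as ℤ using (ℤ)
open import Data.Integer.Divisibility using () renaming (_∣_ to _∣ℤ_)
open import Data.Sign using (Sign; opposite) renaming (_*_ to _*ₛ_)
import Data.Sign as S
open import Relation.Binary.PropositionalEquality using (_≡_)
open import Relation.Nullary using (¬_; yes; no)

-- Each edge e has
-- two half-edges (e , i), i : Fin 2, and  end e i  is the end of that
-- half-edge.  Loops (end e 0 ≡ end e 1) and parallel edges are allowed.
-- σ is the signature, τ the orientation of the half-edges, subject to
-- τ(e,0) τ(e,1) = - σ(e).
record BidirectedGraph : Set where
  field
    nV  : ℕ
    nE  : ℕ
    end : Fin nE → Fin 2 → Fin nV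
    σ   : Fin nE → Sign
    τ   : Fin nE → Fin 2 → Sign
    bidirected : ∀ e → τ e F.zero *ₛ τ e (F.suc F.zero) ≡ opposite (σ e)
open BidirectedGraph public

sumFin : (k : ℕ) → (Fin k → ℤ) → ℤ
sumFin zero    f = ℤ.+ 0
sumFin (suc k) f = f F.zero ℤ.+ sumFin k (λ i → f (F.suc i))

prodSign : (k : ℕ) → (Fin k → Sign) → Sign
prodSign zero    f = S.+
prodSign (suc k) f = f F.zero *ₛ prodSign k (λ i → f (F.suc i))

signℤ : Sign → ℤ
signℤ S.+ = ℤ.+ 1
signℤ S.- = ℤ.- (ℤ.+ 1)

other : Fin 2 → Fin 2
other F.zero = F.suc F.zero
other (F.suc _) = F.zero

data Reachable (G : BidirectedGraph) : Fin (nV G) → Fin (nV G) → Set where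
  here : ∀ {u} → Reachable G u u
  step : ∀ {u w} (e : Fin (nE G)) (i : Fin 2) →
         end G e i ≡ u → Reachable G (end G e (other i)) w →
         Reachable G u w

Connected : BidirectedGraph → Set
Connected G = ∀ u v → Reachable G u v

halfContribution : (G : BidirectedGraph) → (Fin (nE G) → ℤ) →
                   Fin (nV G) → Fin (nE G) → Fin 2 → ℤ
halfContribution G φ v e i with end G e i ≟ v
... | yes _ = signℤ (τ G e i) ℤ.* φ e
... | no  _ = ℤ.+ 0

∂ : (G : BidirectedGraph) → (Fin (nE G) → ℤ) → Fin (nV G) → ℤ
∂ G φ v = sumFin (nE G) λ e → sumFin 2 λ i → halfContribution G φ v e i

IsℤFlow : (G : BidirectedGraph) → (Fin (nE G) → ℤ) → Set
IsℤFlow G φ = ∀ v → ∂ G φ v ≡ ℤ.+ 0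

-- ℤ_p is represented by Fin p (residues 0..p-1); a ℤ_p-valued map is
-- lifted to ℤ by its residues, and the ℤ_p-boundary vanishes iff p
-- divides the integer boundary of the lift.
liftℤ : {p : ℕ} {k : ℕ} → (Fin k → Fin p) → Fin k → ℤ
liftℤ ψ e = ℤ.+ toℕ (ψ e)

IsℤₚFlow : (G : BidirectedGraph) (p : ℕ) → (Fin (nE G) → Fin p) → Set
IsℤₚFlow G p ψ = ∀ v → ℤ.+ p ∣ℤ ∂ G (liftℤ ψ) v

σsupp : (G : BidirectedGraph) {p : ℕ} → (Fin (nE G) → Fin p) → Sign
σsupp G ψ = prodSign (nE G) λ e → sigOrOne (toℕ (ψ e)) e
  where
  sigOrOne : ℕ → Fin (nE G) → Sign
  sigOrOne zero    e = S.+
  sigOrOne (suc _) e = σ G e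

module Submission where

-- Let ψ̂ be the residue lift of ψ, so ∂ψ̂ = p q for an integer charge q.  Sending
-- c along a walk W from u to w gives an integer function with boundary c at u
-- and -sgn(W) c at w.  Moving every charge q(u) to a root r along fixed walks
-- and subtracting p times the result yields Φ₁ ≡ ψ (mod p) with ∂Φ₁ = p B [r].
-- Summing ∂Φ₁ over all vertices counts each edge twice, so p B = 2 Y: hence B
-- is even if p is odd, and for p = 2, Y ≡ bit σ_G(supp ψ) (mod 2).  Then either
--   * some closed walk is negative, which with a walk to r gives a function of
--     boundary 2 [r], and subtracting p B/2 copies of it makes Φ₁ a flow; or
--   * the signs of the walks to r form a switching s, and Σ_v s(v) ∂φ(v) = 0 for
--     every φ forces p B = 0, so Φ₁ is already a flow.

open import Defs
open import Data.Nat using (ℕ; zero; suc)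
open import Data.Nat.Primality using (Prime; prime[2]; prime⇒irreducible; euclidsLemma)
open import Data.Nat.Divisibility using (_∣_; _∣?_)
open import Data.Fin using (Fin; zero; suc; toℕ; _≟_)
import Data.Fin.Properties as FP
open import Data.Integer as ℤ using (ℤ; _+_; _*_; -_; _-_; +_; 0ℤ; 1ℤ)
open import Data.Integer.Properties
  using (+-*-semiring; +-identityˡ; +-identityʳ; +-inverseʳ; +-comm; *-identityˡ; *-identityʳ; *-zeroʳ;
         *-comm; *-assoc; *-distribˡ-+; *-cancelˡ-≡; neg-involutive; -1*i≡-i; abs-*)
open import Data.Integer.Tactic.RingSolver using (solve-∀)
open import Data.Integer.Divisibility using () renaming (_∣_ to _∣ℤ_)
open import Data.Integer.Divisibility.Signed
  using (divides; quotient; ∣ᵤ⇒∣; ∣⇒∣ᵤ; ∣m∣n⇒∣m+n; ∣n⇒∣m*n) renaming (_∣_ to _∣ˢ_)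
open import Algebra.Properties.Semiring.Sum +-*-semiring
  using (sum-syntax; sum-cong-≗; sum-replicate-zero; ∑-distrib-+; ∑-comm; *-distribˡ-sum; *-distribʳ-sum)
open import Data.Sign as S using (Sign)
import Data.Sign.Properties as SP
open import Algebra.Properties.Group SP.*-group using (x∙y⁻¹≈ε⇒x≈y)
open import Data.Sum using (_⊎_; inj₁; inj₂)
open import Data.Product using (Σ; _×_; _,_)
open import Data.Empty using (⊥-elim)
open import Relation.Binary.PropositionalEquality
open import Relation.Nullary using (¬_; yes; no)

sumFin≡∑ : ∀ k (f : Fin k → ℤ) → sumFin k f ≡ ∑[ i < k ] f i
sumFin≡∑ zero    f = refl
sumFin≡∑ (suc k) f = cong (_+_ (f zero)) (sumFin≡∑ k (λ i → f (suc i)))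

δ : ∀ {n} → Fin n → Fin n → ℤ
δ a b with a ≟ b
... | yes _ = 1ℤ
... | no  _ = 0ℤ

δ-sym : ∀ {n} (a b : Fin n) → δ a b ≡ δ b a
δ-sym a b with a ≟ b | b ≟ a
... | yes _   | yes _   = refl
... | no  _   | no  _   = refl
... | yes a≡b | no  b≢a = ⊥-elim (b≢a (sym a≡b))
... | no  a≢b | yes b≡a = ⊥-elim (a≢b (sym b≡a))

δ-suc : ∀ {n} (a b : Fin n) → δ (suc a) (suc b) ≡ δ a b
δ-suc a b with a ≟ b
... | yes _ = refl
... | no  _ = refl

∑-δ : ∀ {n} (a : Fin n) (f : Fin n → ℤ) → ∑[ v < n ] (δ a v * f v) ≡ f a
∑-δ {suc n} zero f = begin
    1ℤ * f zero + ∑[ v < n ] (0ℤ * f (suc v))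
  ≡⟨ cong (_+_ (1ℤ * f zero)) (sum-replicate-zero n) ⟩
    1ℤ * f zero + 0ℤ
  ≡⟨ trans (+-identityʳ _) (*-identityˡ _) ⟩
    f zero
  ∎
  where open ≡-Reasoning
∑-δ {suc n} (suc a) f = begin
    0ℤ * f zero + ∑[ v < n ] (δ (suc a) (suc v) * f (suc v))
  ≡⟨ cong (_+_ (0ℤ * f zero)) (sum-cong-≗ (λ v → cong (_* f (suc v)) (δ-suc a v))) ⟩
    0ℤ * f zero + ∑[ v < n ] (δ a v * f (suc v))
  ≡⟨ cong (_+_ (0ℤ * f zero)) (∑-δ a (λ v → f (suc v))) ⟩
    0ℤ * f zero + f (suc a)
  ≡⟨ +-identityˡ _ ⟩
    f (suc a)
  ∎
  where open ≡-Reasoning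

∑-δʳ : ∀ {n} (a : Fin n) (f : Fin n → ℤ) → ∑[ v < n ] (f v * δ a v) ≡ f a
∑-δʳ a f = trans (sum-cong-≗ (λ v → *-comm (f v) (δ a v))) (∑-δ a f)

signℤ-* : ∀ s t → signℤ (s S.* t) ≡ signℤ s * signℤ t
signℤ-* S.+ S.+ = refl
signℤ-* S.+ S.- = refl
signℤ-* S.- S.+ = refl
signℤ-* S.- S.- = refl

signℤ-opposite : ∀ s → signℤ (S.opposite s) ≡ - signℤ s
signℤ-opposite S.+ = refl
signℤ-opposite S.- = refl

signℤ-square : ∀ s → signℤ s * signℤ s ≡ 1ℤ
signℤ-square S.+ = refl
signℤ-square S.- = refl

unit-row : ∀ t u s → t * t ≡ 1ℤ → t * u ≡ - s → ∀ d d′ → t * (t * d + u * d′) ≡ d - s * d′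
unit-row t u s tt≡1 tu≡-s d d′ = begin
    t * (t * d + u * d′)
  ≡⟨ expand t u d d′ ⟩
    t * t * d + t * u * d′
  ≡⟨ cong₂ (λ x y → x * d + y * d′) tt≡1 tu≡-s ⟩
    1ℤ * d + - s * d′
  ≡⟨ simplify s d d′ ⟩
    d - s * d′
  ∎
  where
  open ≡-Reasoning
  expand : ∀ t u d d′ → t * (t * d + u * d′) ≡ t * t * d + t * u * d′
  expand = solve-∀
  simplify : ∀ s d d′ → 1ℤ * d + - s * d′ ≡ d - s * d′
  simplify = solve-∀

signℤ-cancel : ∀ t x → signℤ t * x ≡ 0ℤ → x ≡ 0ℤ
signℤ-cancel S.+ x tx≡0 = trans (sym (*-identityˡ x)) tx≡0
signℤ-cancel S.- x tx≡0 = trans (sym (neg-involutive x)) (trans (cong -_ (sym (-1*i≡-i x))) (cong -_ tx≡0))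

sign-agree : ∀ s t → s S.* t ≡ S.+ → s ≡ t
sign-agree = x∙y⁻¹≈ε⇒x≈y

not-negative : ∀ s → ¬ s ≡ S.- → s ≡ S.+
not-negative S.+ _ = refl
not-negative S.- s≢- = ⊥-elim (s≢- refl)

τℤ : (G : BidirectedGraph) → Fin (nE G) → Fin 2 → ℤ
τℤ G e i = signℤ (τ G e i)

incidence : (G : BidirectedGraph) → Fin (nV G) → Fin (nE G) → ℤ
incidence G v e = τℤ G e zero * δ (end G e zero) v + τℤ G e (suc zero) * δ (end G e (suc zero)) v

coboundary : (G : BidirectedGraph) → (Fin (nV G) → ℤ) → Fin (nE G) → ℤ
coboundary G w e = w (end G e zero) * τℤ G e zero + w (end G e (suc zero)) * τℤ G e (suc zero)

module _ (G : BidirectedGraph) where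

  halfContribution≡ : ∀ φ v e i → halfContribution G φ v e i ≡ τℤ G e i * δ (end G e i) v * φ e
  halfContribution≡ φ v e i with end G e i ≟ v
  ... | yes _ = cong (_* φ e) (sym (*-identityʳ (τℤ G e i)))
  ... | no  _ = sym (cong (_* φ e) (*-zeroʳ (τℤ G e i)))

  ∂-incidence : ∀ φ v → ∂ G φ v ≡ ∑[ e < nE G ] (incidence G v e * φ e)
  ∂-incidence φ v = trans (sumFin≡∑ (nE G) _) (sum-cong-≗ perEdge)
    where
    collect : ∀ a b x → a * x + (b * x + 0ℤ) ≡ (a + b) * x
    collect = solve-∀
    perEdge : ∀ e → sumFin 2 (halfContribution G φ v e) ≡ incidence G v e * φ e
    perEdge e = trans (cong₂ (λ x y → x + (y + 0ℤ)) (halfContribution≡ φ v e zero) (halfContribution≡ φ v e (suc zero)))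
                      (collect (τℤ G e zero * δ (end G e zero) v) (τℤ G e (suc zero) * δ (end G e (suc zero)) v) (φ e))

  ∂-+ : ∀ φ ψ v → ∂ G (λ e → φ e + ψ e) v ≡ ∂ G φ v + ∂ G ψ v
  ∂-+ φ ψ v = begin
      ∂ G (λ e → φ e + ψ e) v
    ≡⟨ ∂-incidence _ v ⟩
      ∑[ e < nE G ] (incidence G v e * (φ e + ψ e))
    ≡⟨ sum-cong-≗ (λ e → *-distribˡ-+ (incidence G v e) (φ e) (ψ e)) ⟩
      ∑[ e < nE G ] (incidence G v e * φ e + incidence G v e * ψ e)
    ≡⟨ ∑-distrib-+ (λ e → incidence G v e * φ e) (λ e → incidence G v e * ψ e) ⟩
      ∑[ e < nE G ] (incidence G v e * φ e) + ∑[ e < nE G ] (incidence G v e * ψ e)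
    ≡⟨ sym (cong₂ _+_ (∂-incidence φ v) (∂-incidence ψ v)) ⟩
      ∂ G φ v + ∂ G ψ v
    ∎
    where open ≡-Reasoning

  ∂-scale : ∀ c φ v → ∂ G (λ e → c * φ e) v ≡ c * ∂ G φ v
  ∂-scale c φ v = begin
      ∂ G (λ e → c * φ e) v
    ≡⟨ ∂-incidence _ v ⟩
      ∑[ e < nE G ] (incidence G v e * (c * φ e))
    ≡⟨ sum-cong-≗ (λ e → pull (incidence G v e) c (φ e)) ⟩
      ∑[ e < nE G ] (c * (incidence G v e * φ e))
    ≡⟨ sym (*-distribˡ-sum c (λ e → incidence G v e * φ e)) ⟩
      c * ∑[ e < nE G ] (incidence G v e * φ e)
    ≡⟨ cong (c *_) (sym (∂-incidence φ v)) ⟩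
      c * ∂ G φ v
    ∎
    where
    open ≡-Reasoning
    pull : ∀ a c x → a * (c * x) ≡ c * (a * x)
    pull = solve-∀

  ∂-zero : ∀ v → ∂ G (λ _ → 0ℤ) v ≡ 0ℤ
  ∂-zero v = trans (∂-incidence _ v)
                   (trans (sum-cong-≗ (λ e → *-zeroʳ (incidence G v e))) (sum-replicate-zero (nE G)))

  ∂-∑ : ∀ k (H : Fin k → Fin (nE G) → ℤ) v → ∂ G (λ e → ∑[ j < k ] H j e) v ≡ ∑[ j < k ] ∂ G (H j) v
  ∂-∑ k H v = begin
      ∂ G (λ e → ∑[ j < k ] H j e) v
    ≡⟨ ∂-incidence _ v ⟩
      ∑[ e < nE G ] (incidence G v e * ∑[ j < k ] H j e)
    ≡⟨ sum-cong-≗ (λ e → *-distribˡ-sum (incidence G v e) (λ j → H j e)) ⟩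
      ∑[ e < nE G ] ∑[ j < k ] (incidence G v e * H j e)
    ≡⟨ ∑-comm (λ e j → incidence G v e * H j e) ⟩
      ∑[ j < k ] ∑[ e < nE G ] (incidence G v e * H j e)
    ≡⟨ sum-cong-≗ (λ j → sym (∂-incidence (H j) v)) ⟩
      ∑[ j < k ] ∂ G (H j) v
    ∎
    where open ≡-Reasoning

  ∂-edge : ∀ e x v → ∂ G (λ e′ → x * δ e e′) v ≡ x * incidence G v e
  ∂-edge e x v = begin
      ∂ G (λ e′ → x * δ e e′) v
    ≡⟨ ∂-incidence _ v ⟩
      ∑[ e′ < nE G ] (incidence G v e′ * (x * δ e e′))
    ≡⟨ sum-cong-≗ (λ e′ → rearrange (incidence G v e′) x (δ e e′)) ⟩
      ∑[ e′ < nE G ] (δ e e′ * (x * incidence G v e′))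
    ≡⟨ ∑-δ e _ ⟩
      x * incidence G v e
    ∎
    where
    open ≡-Reasoning
    rearrange : ∀ a x d → a * (x * d) ≡ d * (x * a)
    rearrange = solve-∀

  ∑-weighted-incidence : ∀ w e → ∑[ v < nV G ] (w v * incidence G v e) ≡ coboundary G w e
  ∑-weighted-incidence w e = begin
      ∑[ v < nV G ] (w v * incidence G v e)
    ≡⟨ sum-cong-≗ (λ v → split (w v) t₀ t₁ (δ a v) (δ b v)) ⟩
      ∑[ v < nV G ] (t₀ * (δ a v * w v) + t₁ * (δ b v * w v))
    ≡⟨ ∑-distrib-+ (λ v → t₀ * (δ a v * w v)) (λ v → t₁ * (δ b v * w v)) ⟩
      ∑[ v < nV G ] (t₀ * (δ a v * w v)) + ∑[ v < nV G ] (t₁ * (δ b v * w v))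
    ≡⟨ sym (cong₂ _+_ (*-distribˡ-sum t₀ (λ v → δ a v * w v)) (*-distribˡ-sum t₁ (λ v → δ b v * w v))) ⟩
      t₀ * ∑[ v < nV G ] (δ a v * w v) + t₁ * ∑[ v < nV G ] (δ b v * w v)
    ≡⟨ cong₂ (λ x y → t₀ * x + t₁ * y) (∑-δ a w) (∑-δ b w) ⟩
      t₀ * w a + t₁ * w b
    ≡⟨ cong₂ _+_ (*-comm t₀ (w a)) (*-comm t₁ (w b)) ⟩
      coboundary G w e
    ∎
    where
    open ≡-Reasoning
    a = end G e zero
    b = end G e (suc zero)
    t₀ = τℤ G e zero
    t₁ = τℤ G e (suc zero)
    split : ∀ x t₀ t₁ d₀ d₁ → x * (t₀ * d₀ + t₁ * d₁) ≡ t₀ * (d₀ * x) + t₁ * (d₁ * x)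
    split = solve-∀

  ∑-weighted-∂ : ∀ w φ → ∑[ v < nV G ] (w v * ∂ G φ v) ≡ ∑[ e < nE G ] (coboundary G w e * φ e)
  ∑-weighted-∂ w φ = begin
      ∑[ v < nV G ] (w v * ∂ G φ v)
    ≡⟨ sum-cong-≗ (λ v → cong (w v *_) (∂-incidence φ v)) ⟩
      ∑[ v < nV G ] (w v * ∑[ e < nE G ] (incidence G v e * φ e))
    ≡⟨ sum-cong-≗ (λ v → *-distribˡ-sum (w v) (λ e → incidence G v e * φ e)) ⟩
      ∑[ v < nV G ] ∑[ e < nE G ] (w v * (incidence G v e * φ e))
    ≡⟨ ∑-comm (λ v e → w v * (incidence G v e * φ e)) ⟩
      ∑[ e < nE G ] ∑[ v < nV G ] (w v * (incidence G v e * φ e))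
    ≡⟨ sum-cong-≗ (λ e → sum-cong-≗ (λ v → sym (*-assoc (w v) (incidence G v e) (φ e)))) ⟩
      ∑[ e < nE G ] ∑[ v < nV G ] (w v * incidence G v e * φ e)
    ≡⟨ sum-cong-≗ (λ e → sym (*-distribʳ-sum (φ e) (λ v → w v * incidence G v e))) ⟩
      ∑[ e < nE G ] (∑[ v < nV G ] (w v * incidence G v e) * φ e)
    ≡⟨ sum-cong-≗ (λ e → cong (_* φ e) (∑-weighted-incidence w e)) ⟩
      ∑[ e < nE G ] (coboundary G w e * φ e)
    ∎
    where open ≡-Reasoning

_++_ : ∀ {G u w x} → Reachable G u w → Reachable G w x → Reachable G u x
here          ++ W′ = W′
step e i eq W ++ W′ = step e i eq (W ++ W′)

module _ (G : BidirectedGraph) where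

  τ₀τ₁ : ∀ e → τℤ G e zero * τℤ G e (suc zero) ≡ - signℤ (σ G e)
  τ₀τ₁ e = begin
      τℤ G e zero * τℤ G e (suc zero)
    ≡⟨ sym (signℤ-* (τ G e zero) (τ G e (suc zero))) ⟩
      signℤ (τ G e zero S.* τ G e (suc zero))
    ≡⟨ cong signℤ (bidirected G e) ⟩
      signℤ (S.opposite (σ G e))
    ≡⟨ signℤ-opposite (σ G e) ⟩
      - signℤ (σ G e)
    ∎
    where open ≡-Reasoning

  τ-incidence : ∀ e i v →
    τℤ G e i * incidence G v e ≡ δ (end G e i) v - signℤ (σ G e) * δ (end G e (other i)) v
  τ-incidence e zero v =
    unit-row (τℤ G e zero) (τℤ G e (suc zero)) (signℤ (σ G e)) (signℤ-square (τ G e zero)) (τ₀τ₁ e)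
             (δ (end G e zero) v) (δ (end G e (suc zero)) v)
  τ-incidence e (suc zero) v =
    trans (cong (τℤ G e (suc zero) *_) (+-comm (τℤ G e zero * δ (end G e zero) v) _))
          (unit-row (τℤ G e (suc zero)) (τℤ G e zero) (signℤ (σ G e)) (signℤ-square (τ G e (suc zero)))
                    (trans (*-comm (τℤ G e (suc zero)) (τℤ G e zero)) (τ₀τ₁ e))
                    (δ (end G e (suc zero)) v) (δ (end G e zero) v))

  sgn : ∀ {u w} → Reachable G u w → Sign
  sgn here           = S.+
  sgn (step e _ _ W) = σ G e S.* sgn W

  sgn-++ : ∀ {u w x} (W : Reachable G u w) (W′ : Reachable G w x) → sgn (W ++ W′) ≡ sgn W S.* sgn W′
  sgn-++ here           W′ = refl
  sgn-++ (step e _ _ W) W′ = trans (cong (σ G e S.*_) (sgn-++ W W′)) (sym (SP.*-assoc (σ G e) (sgn W) (sgn W′)))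

  -- Sending the value c along a walk: each traversed edge carries the value
  -- that cancels the boundary left at its entry end.
  walkFlow : ∀ {u w} → Reachable G u w → ℤ → Fin (nE G) → ℤ
  walkFlow here           c e′ = 0ℤ
  walkFlow (step e i _ W) c e′ = τℤ G e i * c * δ e e′ + walkFlow W (signℤ (σ G e) * c) e′

  ∂-walkFlow : ∀ {u w} (W : Reachable G u w) c v →
    ∂ G (walkFlow W c) v ≡ c * δ u v - signℤ (sgn W) * c * δ w v
  ∂-walkFlow {u} here c v = trans (∂-zero G v) (vanish c (δ u v))
    where
    vanish : ∀ c d → 0ℤ ≡ c * d - 1ℤ * c * d
    vanish = solve-∀
  ∂-walkFlow {w = w} (step e i refl W) c v = begin
      ∂ G (walkFlow (step e i refl W) c) v
    ≡⟨ ∂-+ G (λ e′ → τℤ G e i * c * δ e e′) (walkFlow W (s * c)) v ⟩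
      ∂ G (λ e′ → τℤ G e i * c * δ e e′) v + ∂ G (walkFlow W (s * c)) v
    ≡⟨ cong₂ _+_ (∂-edge G e (τℤ G e i * c) v) (∂-walkFlow W (s * c) v) ⟩
      τℤ G e i * c * incidence G v e + (s * c * δ b v - S * (s * c) * δ w v)
    ≡⟨ cong (_+ (s * c * δ b v - S * (s * c) * δ w v)) (trans (swap (τℤ G e i) c _) (cong (c *_) (τ-incidence e i v))) ⟩
      c * (δ a v - s * δ b v) + (s * c * δ b v - S * (s * c) * δ w v)
    ≡⟨ telescope c s S (δ a v) (δ b v) (δ w v) ⟩
      c * δ a v - s * S * c * δ w v
    ≡⟨ cong (λ z → c * δ a v - z * c * δ w v) (sym (signℤ-* (σ G e) (sgn W))) ⟩
      c * δ a v - signℤ (sgn (step e i refl W)) * c * δ w v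
    ∎
    where
    open ≡-Reasoning
    a = end G e i
    b = end G e (other i)
    s = signℤ (σ G e)
    S = signℤ (sgn W)
    swap : ∀ t c x → t * c * x ≡ c * (t * x)
    swap = solve-∀
    telescope : ∀ c s S da db dw → c * (da - s * db) + (s * c * db - S * (s * c) * dw) ≡ c * da - s * S * c * dw
    telescope = solve-∀


  doubling : ∀ {a w} → Reachable G a a → Reachable G a w → Fin (nE G) → ℤ
  doubling C W e = walkFlow C s e + walkFlow W (- (+ 2 * s)) e
    where s = signℤ (sgn W)

  ∂-doubling : ∀ {a w} (C : Reachable G a a) → sgn C ≡ S.- → (W : Reachable G a w) →
    ∀ v → ∂ G (doubling C W) v ≡ + 2 * δ w v
  ∂-doubling {a} {w} C negative W v = begin
      ∂ G (doubling C W) v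
    ≡⟨ ∂-+ G (walkFlow C s) (walkFlow W (- (+ 2 * s))) v ⟩
      ∂ G (walkFlow C s) v + ∂ G (walkFlow W (- (+ 2 * s))) v
    ≡⟨ cong₂ _+_ (∂-walkFlow C s v) (∂-walkFlow W (- (+ 2 * s)) v) ⟩
      (s * δ a v - signℤ (sgn C) * s * δ a v) + (- (+ 2 * s) * δ a v - s * - (+ 2 * s) * δ w v)
    ≡⟨ cong (λ t → (s * δ a v - signℤ t * s * δ a v) + (- (+ 2 * s) * δ a v - s * - (+ 2 * s) * δ w v)) negative ⟩
      (s * δ a v - - 1ℤ * s * δ a v) + (- (+ 2 * s) * δ a v - s * - (+ 2 * s) * δ w v)
    ≡⟨ collect s (δ a v) (δ w v) ⟩
      + 2 * (s * s) * δ w v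
    ≡⟨ cong (λ t → + 2 * t * δ w v) (signℤ-square (sgn W)) ⟩
      + 2 * 1ℤ * δ w v
    ≡⟨ cong (_* δ w v) (*-identityʳ (+ 2)) ⟩
      + 2 * δ w v
    ∎
    where
    open ≡-Reasoning
    s = signℤ (sgn W)
    collect : ∀ s da dw → (s * da - - 1ℤ * s * da) + (- (+ 2 * s) * da - s * - (+ 2 * s) * dw) ≡ + 2 * (s * s) * dw
    collect = solve-∀

switching-balances : ∀ sa sb t₀ t₁ → t₀ S.* t₁ ≡ S.opposite (sa S.* sb) →
  signℤ sa * signℤ t₀ + signℤ sb * signℤ t₁ ≡ 0ℤ
switching-balances S.+ S.+ S.+ _ refl = refl
switching-balances S.+ S.- S.+ _ refl = refl
switching-balances S.- S.+ S.+ _ refl = refl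
switching-balances S.- S.- S.+ _ refl = refl
switching-balances S.+ S.+ S.- S.+ refl = refl
switching-balances S.+ S.- S.- S.- refl = refl
switching-balances S.- S.+ S.- S.- refl = refl
switching-balances S.- S.- S.- S.+ refl = refl
switching-balances S.+ S.+ S.- S.- ()
switching-balances S.+ S.- S.- S.+ ()
switching-balances S.- S.+ S.- S.+ ()
switching-balances S.- S.- S.- S.- ()

module _ (G : BidirectedGraph) where

  NegativeClosedWalk : Set
  NegativeClosedWalk = Σ (Fin (nV G)) λ a → Σ (Reachable G a a) λ C → sgn G C ≡ S.-

  IsSwitching : (Fin (nV G) → Sign) → Set
  IsSwitching s = ∀ e → σ G e ≡ s (end G e zero) S.* s (end G e (suc zero))

  switching-⊥-∂ : ∀ s → IsSwitching s → ∀ φ → ∑[ v < nV G ] (signℤ (s v) * ∂ G φ v) ≡ 0ℤ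
  switching-⊥-∂ s switching φ = begin
      ∑[ v < nV G ] (signℤ (s v) * ∂ G φ v)
    ≡⟨ ∑-weighted-∂ G (λ v → signℤ (s v)) φ ⟩
      ∑[ e < nE G ] (coboundary G (λ v → signℤ (s v)) e * φ e)
    ≡⟨ sum-cong-≗ (λ e → cong (_* φ e) (coboundary-vanishes e)) ⟩
      ∑[ e < nE G ] (0ℤ * φ e)
    ≡⟨ sum-replicate-zero (nE G) ⟩
      0ℤ
    ∎
    where
    open ≡-Reasoning
    coboundary-vanishes : ∀ e → coboundary G (λ v → signℤ (s v)) e ≡ 0ℤ
    coboundary-vanishes e =
      switching-balances (s (end G e zero)) (s (end G e (suc zero))) (τ G e zero) (τ G e (suc zero))
        (trans (bidirected G e) (cong S.opposite (switching e)))

half : Sign → Sign → ℤ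
half S.+ S.+ = 1ℤ
half S.+ S.- = 0ℤ
half S.- S.+ = 0ℤ
half S.- S.- = - 1ℤ

twice-half : ∀ t₀ t₁ → signℤ t₀ + signℤ t₁ ≡ + 2 * half t₀ t₁
twice-half S.+ S.+ = refl
twice-half S.+ S.- = refl
twice-half S.- S.+ = refl
twice-half S.- S.- = refl

bit : Sign → ℤ
bit S.+ = 0ℤ
bit S.- = 1ℤ

bit-* : ∀ s t → + 2 ∣ˢ (bit s + bit t - bit (s S.* t))
bit-* S.+ S.+ = divides 0ℤ refl
bit-* S.+ S.- = divides 0ℤ refl
bit-* S.- S.+ = divides 0ℤ refl
bit-* S.- S.- = divides 1ℤ refl

-- An edge is negative exactly when its orientations agree, i.e. when half is odd.
half-bit : ∀ t₀ t₁ → + 2 ∣ˢ (half t₀ t₁ - bit (S.opposite (t₀ S.* t₁)))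
half-bit S.+ S.+ = divides 0ℤ refl
half-bit S.+ S.- = divides 0ℤ refl
half-bit S.- S.+ = divides 0ℤ refl
half-bit S.- S.- = divides (- 1ℤ) refl

∑-bit : ∀ k (f : Fin k → ℤ) (g : Fin k → Sign) → (∀ i → + 2 ∣ˢ (f i - bit (g i))) →
  + 2 ∣ˢ (∑[ i < k ] f i - bit (prodSign k g))
∑-bit zero    f g f≡g = divides 0ℤ refl
∑-bit (suc k) f g f≡g =
  subst (+ 2 ∣ˢ_) (sym (regroup (f zero) (∑[ i < k ] f (suc i)) (bit (g zero)) (bit Πg′) (bit (g zero S.* Πg′))))
    (∣m∣n⇒∣m+n (∣m∣n⇒∣m+n (f≡g zero) (∑-bit k (λ i → f (suc i)) (λ i → g (suc i)) (λ i → f≡g (suc i))))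
               (bit-* (g zero) Πg′))
  where
  Πg′ = prodSign k (λ i → g (suc i))
  regroup : ∀ a s x y z → a + s - z ≡ (a - x) + (s - y) + (x + y - z)
  regroup = solve-∀

-- The factor of edge e in σ_G(supp ψ): σ(e) if ψ(e) ≠ 0 and + otherwise.  It is
-- read off from the definition of σsupp, where it is a local function.
factorOf : ∀ {k} {g : Fin k → Sign} {s} → prodSign k g ≡ s → Fin k → Sign
factorOf {g = g} _ = g

suppFactor : (G : BidirectedGraph) {p : ℕ} → (Fin (nE G) → Fin p) → Fin (nE G) → Sign
suppFactor G ψ = factorOf (refl {x = σsupp G ψ})

module _ (G : BidirectedGraph) where

  halfτ : Fin (nE G) → ℤ
  halfτ e = half (τ G e zero) (τ G e (suc zero))

  halfSum : (Fin (nE G) → ℤ) → ℤ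
  halfSum φ = ∑[ e < nE G ] (halfτ e * φ e)

  -- Every half-edge contributes ±φ(e), so the total boundary is even.
  ∑-∂ : ∀ φ → ∑[ v < nV G ] ∂ G φ v ≡ + 2 * halfSum φ
  ∑-∂ φ = begin
      ∑[ v < nV G ] ∂ G φ v
    ≡⟨ sum-cong-≗ (λ v → sym (*-identityˡ (∂ G φ v))) ⟩
      ∑[ v < nV G ] (1ℤ * ∂ G φ v)
    ≡⟨ ∑-weighted-∂ G (λ _ → 1ℤ) φ ⟩
      ∑[ e < nE G ] ((1ℤ * τℤ G e zero + 1ℤ * τℤ G e (suc zero)) * φ e)
    ≡⟨ sum-cong-≗ (λ e → cong (_* φ e) (trans (cong₂ _+_ (*-identityˡ (τℤ G e zero)) (*-identityˡ (τℤ G e (suc zero))))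
                                                (twice-half (τ G e zero) (τ G e (suc zero))))) ⟩
      ∑[ e < nE G ] (+ 2 * halfτ e * φ e)
    ≡⟨ sum-cong-≗ (λ e → *-assoc (+ 2) (halfτ e) (φ e)) ⟩
      ∑[ e < nE G ] (+ 2 * (halfτ e * φ e))
    ≡⟨ sym (*-distribˡ-sum (+ 2) (λ e → halfτ e * φ e)) ⟩
      + 2 * halfSum φ
    ∎
    where open ≡-Reasoning

  halfτ-parity : (ψ : Fin (nE G) → Fin 2) → ∀ e → + 2 ∣ˢ (halfτ e * liftℤ ψ e - bit (suppFactor G ψ e))
  halfτ-parity ψ e with ψ e
  ... | zero       = divides 0ℤ (trans (+-identityʳ _) (*-zeroʳ (halfτ e)))
  ... | suc zero   = subst (+ 2 ∣ˢ_) (cong₂ _-_ (sym (*-identityʳ (halfτ e))) (cong bit opposite-τ₀τ₁))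
                             (half-bit (τ G e zero) (τ G e (suc zero)))
    where
    opposite-τ₀τ₁ : S.opposite (τ G e zero S.* τ G e (suc zero)) ≡ σ G e
    opposite-τ₀τ₁ = trans (cong S.opposite (bidirected G e)) (SP.opposite-involutive (σ G e))

  halfSum-parity : (ψ : Fin (nE G) → Fin 2) (φ : Fin (nE G) → ℤ) → (∀ e → + 2 ∣ˢ (φ e - liftℤ ψ e)) →
    + 2 ∣ˢ (halfSum φ - bit (σsupp G ψ))
  halfSum-parity ψ φ φ≡ψ = ∑-bit (nE G) (λ e → halfτ e * φ e) (suppFactor G ψ) edge
    where
    split : ∀ h x y b → h * x - b ≡ (h * y - b) + h * (x - y)
    split = solve-∀
    edge : ∀ e → + 2 ∣ˢ (halfτ e * φ e - bit (suppFactor G ψ e))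
    edge e = subst (+ 2 ∣ˢ_) (sym (split (halfτ e) (φ e) (liftℤ ψ e) (bit (suppFactor G ψ e))))
                   (∣m∣n⇒∣m+n (halfτ-parity ψ e) (∣n⇒∣m*n (halfτ e) (φ≡ψ e)))

odd-cancel : ∀ {p} B → ¬ 2 ∣ p → + 2 ∣ˢ (+ p * B) → + 2 ∣ˢ B
odd-cancel {p} B odd 2∣pB with euclidsLemma p ℤ.∣ B ∣ prime[2] (subst (2 ∣_) (abs-* (+ p) B) (∣⇒∣ᵤ 2∣pB))
... | inj₁ 2∣p = ⊥-elim (odd 2∣p)
... | inj₂ 2∣B = ∣ᵤ⇒∣ 2∣B

even-prime : ∀ {p} → Prime p → 2 ∣ p → p ≡ 2
even-prime p-prime 2∣p with prime⇒irreducible p-prime 2∣p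
... | inj₁ ()
... | inj₂ 2≡p = sym 2≡p

even-at-2 : (G : BidirectedGraph) {p : ℕ} (ψ : Fin (nE G) → Fin p) → p ≡ 2 → σsupp G ψ ≡ S.+ →
  (φ : Fin (nE G) → ℤ) → (∀ e → + p ∣ˢ (φ e - liftℤ ψ e)) →
  ∀ B → + p * B ≡ + 2 * halfSum G φ → + 2 ∣ˢ B
even-at-2 G ψ refl σ₊ φ φ≡ψ B pB≡2Y =
  subst (+ 2 ∣ˢ_) (sym (trans (*-cancelˡ-≡ (+ 2) B (halfSum G φ) pB≡2Y) (sym (+-identityʳ (halfSum G φ)))))
        (subst (λ s → + 2 ∣ˢ (halfSum G φ - bit s)) σ₊ (halfSum-parity G ψ φ φ≡ψ))

module _ (G : BidirectedGraph) (conn : Connected G) (r : Fin (nV G)) where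

  rootSign : Fin (nV G) → Sign
  rootSign u = sgn G (conn u r)

  rootCharge : (Fin (nV G) → ℤ) → ℤ
  rootCharge c = ∑[ u < nV G ] (signℤ (rootSign u) * c u)

  gather : (Fin (nV G) → ℤ) → Fin (nE G) → ℤ
  gather c e = ∑[ u < nV G ] walkFlow G (conn u r) (c u) e

  ∂-gather : ∀ c v → ∂ G (gather c) v ≡ c v - rootCharge c * δ r v
  ∂-gather c v = begin
      ∂ G (gather c) v
    ≡⟨ ∂-∑ G (nV G) (λ u → walkFlow G (conn u r) (c u)) v ⟩
      ∑[ u < nV G ] ∂ G (walkFlow G (conn u r) (c u)) v
    ≡⟨ sum-cong-≗ (λ u → trans (∂-walkFlow G (conn u r) (c u) v) (split (c u) (δ u v) (s u) (δ r v))) ⟩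
      ∑[ u < nV G ] (δ u v * c u + - δ r v * (s u * c u))
    ≡⟨ ∑-distrib-+ (λ u → δ u v * c u) (λ u → - δ r v * (s u * c u)) ⟩
      ∑[ u < nV G ] (δ u v * c u) + ∑[ u < nV G ] (- δ r v * (s u * c u))
    ≡⟨ cong₂ _+_ (trans (sum-cong-≗ (λ u → cong (_* c u) (δ-sym u v))) (∑-δ v c))
                 (sym (*-distribˡ-sum (- δ r v) (λ u → s u * c u))) ⟩
      c v + - δ r v * rootCharge c
    ≡⟨ tidy (c v) (δ r v) (rootCharge c) ⟩
      c v - rootCharge c * δ r v
    ∎
    where
    open ≡-Reasoning
    s : Fin (nV G) → ℤ
    s u = signℤ (rootSign u)
    split : ∀ c d s dr → c * d - s * c * dr ≡ d * c + - dr * (s * c)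
    split = solve-∀
    tidy : ∀ c dr R → c + - dr * R ≡ c - R * dr
    tidy = solve-∀

  loopAt : ∀ a → Reachable G a a
  loopAt a = conn a r ++ conn r a

  loopThrough : ∀ e → Reachable G (end G e zero) (end G e zero)
  loopThrough e = step e zero refl (conn (end G e (suc zero)) r ++ conn r (end G e zero))

  switching-at : ∀ e → sgn G (loopAt (end G e zero)) ≡ S.+ → sgn G (loopThrough e) ≡ S.+ →
    σ G e ≡ rootSign (end G e zero) S.* rootSign (end G e (suc zero))
  switching-at e loop₊ through₊ = begin
      σ G e
    ≡⟨ sign-agree (σ G e) (B S.* A′) (trans (cong (σ G e S.*_) (sym (sgn-++ G (conn b r) (conn r a)))) through₊) ⟩
      B S.* A′
    ≡⟨ cong (B S.*_) (sym (sign-agree A A′ (trans (sym (sgn-++ G (conn a r) (conn r a))) loop₊))) ⟩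
      B S.* A
    ≡⟨ SP.*-comm B A ⟩
      A S.* B
    ∎
    where
    open ≡-Reasoning
    a = end G e zero
    b = end G e (suc zero)
    A = rootSign a
    B = rootSign b
    A′ = sgn G (conn r a)

  negativeClosedWalk-or-switching : NegativeClosedWalk G ⊎ IsSwitching G rootSign
  negativeClosedWalk-or-switching with FP.any? (λ a → sgn G (loopAt a) SP.≟ S.-)
  ... | yes (a , negative) = inj₁ (a , loopAt a , negative)
  ... | no noNegativeLoop with FP.any? (λ e → sgn G (loopThrough e) SP.≟ S.-)
  ...   | yes (e , negative) = inj₁ (end G e zero , loopThrough e , negative)
  ...   | no noNegativeThrough = inj₂ λ e →
            switching-at e (not-negative _ (λ negative → noNegativeLoop (end G e zero , negative)))
                           (not-negative _ (λ negative → noNegativeThrough (e , negative)))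

module Lifting (G : BidirectedGraph) (conn : Connected G) (p : ℕ)
               (ψ : Fin (nE G) → Fin p) (flow : IsℤₚFlow G p ψ) (r : Fin (nV G)) where

  IntegerLift : Set
  IntegerLift = Σ (Fin (nE G) → ℤ) λ φ → IsℤFlow G φ × (∀ e → + p ∣ℤ (φ e - liftℤ ψ e))

  p∣∂ψ̂ : ∀ v → + p ∣ˢ ∂ G (liftℤ ψ) v
  p∣∂ψ̂ v = ∣ᵤ⇒∣ {+ p} {∂ G (liftℤ ψ) v} (flow v)

  q : Fin (nV G) → ℤ
  q v = quotient (p∣∂ψ̂ v)

  ∂ψ̂≡qp : ∀ v → ∂ G (liftℤ ψ) v ≡ q v * + p
  ∂ψ̂≡qp v = _∣ˢ_.equality (p∣∂ψ̂ v)

  B : ℤ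
  B = rootCharge G conn r q

  Φ₁ : Fin (nE G) → ℤ
  Φ₁ e = liftℤ ψ e + - + p * gather G conn r q e

  ∂Φ₁ : ∀ v → ∂ G Φ₁ v ≡ + p * B * δ r v
  ∂Φ₁ v = begin
      ∂ G Φ₁ v
    ≡⟨ ∂-+ G (liftℤ ψ) (λ e → - + p * gather G conn r q e) v ⟩
      ∂ G (liftℤ ψ) v + ∂ G (λ e → - + p * gather G conn r q e) v
    ≡⟨ cong₂ _+_ (∂ψ̂≡qp v) (trans (∂-scale G (- + p) (gather G conn r q) v) (cong (- + p *_) (∂-gather G conn r q v))) ⟩
      q v * + p + - + p * (q v - B * δ r v)
    ≡⟨ cancel (q v) (+ p) B (δ r v) ⟩
      + p * B * δ r v
    ∎
    where
    open ≡-Reasoning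
    cancel : ∀ q P B d → q * P + - P * (q - B * d) ≡ P * B * d
    cancel = solve-∀

  Φ₁≡ψ : ∀ e → + p ∣ˢ (Φ₁ e - liftℤ ψ e)
  Φ₁≡ψ e = divides (- gather G conn r q e) (difference (liftℤ ψ e) (+ p) (gather G conn r q e))
    where
    difference : ∀ x P g → x + - P * g - x ≡ - g * P
    difference = solve-∀

  pB≡2Y : + p * B ≡ + 2 * halfSum G Φ₁
  pB≡2Y = begin
      + p * B
    ≡⟨ sym (∑-δʳ r (λ _ → + p * B)) ⟩
      ∑[ v < nV G ] (+ p * B * δ r v)
    ≡⟨ sum-cong-≗ (λ v → sym (∂Φ₁ v)) ⟩
      ∑[ v < nV G ] ∂ G Φ₁ v
    ≡⟨ ∑-∂ G Φ₁ ⟩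
      + 2 * halfSum G Φ₁
    ∎
    where open ≡-Reasoning

  B-even : Prime p → ¬ (2 ∣ p) ⊎ σsupp G ψ ≡ S.+ → + 2 ∣ˢ B
  B-even p-prime (inj₁ odd) = odd-cancel B odd 2∣pB
    where 2∣pB = divides (halfSum G Φ₁) (trans pB≡2Y (*-comm (+ 2) (halfSum G Φ₁)))
  B-even p-prime (inj₂ σ₊) with 2 ∣? p
  ... | no  odd  = B-even p-prime (inj₁ odd)
  ... | yes even = even-at-2 G ψ (even-prime p-prime even) σ₊ Φ₁ Φ₁≡ψ B pB≡2Y

  -- Balanced case: weighting by the switching kills p B, so Φ₁ is already a flow.
  lift-balanced : IsSwitching G (rootSign G conn r) → IntegerLift
  lift-balanced switching = Φ₁ , Φ₁-flow , λ e → ∣⇒∣ᵤ (Φ₁≡ψ e)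
    where
    s : Fin (nV G) → ℤ
    s v = signℤ (rootSign G conn r v)
    pB≡0 : + p * B ≡ 0ℤ
    pB≡0 = signℤ-cancel (rootSign G conn r r) (+ p * B) (begin
        s r * (+ p * B)
      ≡⟨ sym (∑-δʳ r (λ v → s v * (+ p * B))) ⟩
        ∑[ v < nV G ] (s v * (+ p * B) * δ r v)
      ≡⟨ sum-cong-≗ (λ v → trans (*-assoc (s v) (+ p * B) (δ r v)) (cong (s v *_) (sym (∂Φ₁ v)))) ⟩
        ∑[ v < nV G ] (s v * ∂ G Φ₁ v)
      ≡⟨ switching-⊥-∂ G (rootSign G conn r) switching Φ₁ ⟩
        0ℤ
      ∎)
      where open ≡-Reasoning
    Φ₁-flow : IsℤFlow G Φ₁
    Φ₁-flow v = trans (∂Φ₁ v) (cong (_* δ r v) pB≡0)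

  -- Unbalanced case: with B = 2 B′, subtract p B′ times a doubling that ends at r.
  lift-unbalanced : NegativeClosedWalk G → + 2 ∣ˢ B → IntegerLift
  lift-unbalanced (a , C , negative) (divides B′ B≡B′2) = Φ , Φ-flow , λ e → ∣⇒∣ᵤ (Φ≡ψ e)
    where
    χ : Fin (nE G) → ℤ
    χ = doubling G C (conn a r)
    Φ : Fin (nE G) → ℤ
    Φ e = Φ₁ e + - (+ p * B′) * χ e
    Φ-flow : IsℤFlow G Φ
    Φ-flow v = begin
        ∂ G Φ v
      ≡⟨ ∂-+ G Φ₁ (λ e → - (+ p * B′) * χ e) v ⟩
        ∂ G Φ₁ v + ∂ G (λ e → - (+ p * B′) * χ e) v
      ≡⟨ cong₂ _+_ (∂Φ₁ v) (trans (∂-scale G (- (+ p * B′)) χ v)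
                                  (cong (- (+ p * B′) *_) (∂-doubling G C negative (conn a r) v))) ⟩
        + p * B * δ r v + - (+ p * B′) * (+ 2 * δ r v)
      ≡⟨ cong (λ b → + p * b * δ r v + - (+ p * B′) * (+ 2 * δ r v)) B≡B′2 ⟩
        + p * (B′ * + 2) * δ r v + - (+ p * B′) * (+ 2 * δ r v)
      ≡⟨ cancel (+ p) B′ (δ r v) ⟩
        0ℤ
      ∎
      where
      open ≡-Reasoning
      cancel : ∀ P B′ d → P * (B′ * + 2) * d + - (P * B′) * (+ 2 * d) ≡ 0ℤ
      cancel = solve-∀
    Φ≡ψ : ∀ e → + p ∣ˢ (Φ e - liftℤ ψ e)
    Φ≡ψ e = subst (+ p ∣ˢ_) (sym (regroup (Φ₁ e) (liftℤ ψ e) (+ p) B′ (χ e)))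
                  (∣m∣n⇒∣m+n (Φ₁≡ψ e) (divides (- (B′ * χ e)) (commute (+ p) B′ (χ e))))
      where
      regroup : ∀ x y P B′ c → x + - (P * B′) * c - y ≡ (x - y) + - (P * B′) * c
      regroup = solve-∀
      commute : ∀ P B′ c → - (P * B′) * c ≡ - (B′ * c) * P
      commute = solve-∀

vertex-or-none : ∀ n → Fin n ⊎ ¬ Fin n
vertex-or-none zero    = inj₂ λ ()
vertex-or-none (suc n) = inj₁ zero

lemma2p5 : (G : BidirectedGraph) → Connected G →
    (p : ℕ) → Prime p →
    (ψ : Fin (nE G) → Fin p) → IsℤₚFlow G p ψ →
    (¬ (2 ∣ p) ⊎ σsupp G ψ ≡ S.+) →
    Σ (Fin (nE G) → ℤ) λ φ →
      IsℤFlow G φ × (∀ e → ℤ.+ p ∣ℤ (φ e ℤ.- ℤ.+ toℕ (ψ e)))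
lemma2p5 G conn p p-prime ψ flow parity with vertex-or-none (nV G)
... | inj₂ noVertex =
  liftℤ ψ , (λ v → ⊥-elim (noVertex v)) , λ e → ∣⇒∣ᵤ {+ p} (divides 0ℤ (+-inverseʳ (liftℤ ψ e)))
... | inj₁ r with negativeClosedWalk-or-switching G conn r
...   | inj₁ negative  = lift-unbalanced negative (B-even p-prime parity)
  where open Lifting G conn p ψ flow r
...   | inj₂ switching = lift-balanced switching
  where open Lifting G conn p ψ flow r
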